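{- Let $\mathcal{M}=(E,\mathcal{C})$ be a loopless oriented matroid with ground set $E=\{e_1,\dots,e_m\}$ totally ordered by $e_1\prec\cdots\prec e_m$, and $E_k=\{e_1,\dots,e_k\}$. For $N\subseteq E_k$ write $N^c=E_k-N$. Let $\mathscr{N}_k$ be the set of pairs $(N_k,A_k)$ with $N_k\subseteq E_k$, $A_k\subseteq E-E_k$, $N_k$ an NBC subset of $\underline{\mathcal{M}}$, and $\mathcal{M}_k:={}_{ -A_k}(\mathcal{M}\backslash N_k^c/N_k)$ acyclic. For $1\le k\le m$ define $\psi_k:\mathscr{N}_{k-1}\to\mathscr{N}_k$ by $$\psi_k(N_{k-1},A_{k-1})=\begin{cases}(N_{k-1}\cup\{e_k\},A_{k-1}) & \text{if } e_k\notin A_{k-1}\text{ and } {}_{ -\{e_k\}}\mathcal{M}_{k-1}\text{ is acyclic};\\ (N_{k-1},A_{k-1}) & \text{if } e_k\notin A_{k-1}\text{ and } {}_{ -\{e_k\}}\mathcal{M}_{k-1}\text{ is not acyclic};\\ (N_{k-1},A_{k-1}-\{e_k\}) & \text{if } e_k\in A_{k-1},\end{cases}$$ where $\mathcal{M}_{k-1}={}_{ -A_{k-1}}(\mathcal{M}\backslash N_{k-1}^c/N_{k-1})$. Then $\psi_k$ is surjective.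
   Context: Signed circuits $X=(X^+,X^-)$, support $\underline{X}=X^+\cup X^-$; positive circuit: $X^-=\emptyset$; acyclic: no positive circuits. The underlying matroid $\underline{\mathcal{M}}$ has circuits $\{\underline{X}:X\in\mathcal{C}\}$. A broken circuit is a circuit of $\underline{\mathcal{M}}$ minus its $\prec$-maximal element; an NBC subset contains no broken circuit. Reorientation ${}_{ -A}\mathcal{M}$ has signed circuits $((X^+-A)\cup(X^-\cap A),(X^--A)\cup(X^+\cap A))$. Deletion $\mathcal{M}\backslash S$: signed circuits $Y$ with $\underline{Y}\subseteq E-S$; contraction $\mathcal{M}/S$: support-minimal nonempty members of $\{(Y^+-S,Y^--S):Y\in\mathcal{C}\}$. (That $\psi_k$ maps $\mathscr{N}_{k-1}$ into $\mathscr{N}_k$ is part of the setting.) -}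

module Defs where

open import Data.Nat using (ℕ; suc; _≤_; _<ᵇ_)
open import Data.Bool using (Bool; true; false)
open import Data.Fin using (Fin; toℕ)
open import Data.Fin.Subset using (Subset; _∈_; _∉_; _⊆_; _⊂_; _∪_; _∩_; _─_; ∁; ⁅_⁆; Nonempty)
  renaming (⊥ to ∅)
open import Data.Vec using (tabulate)
open import Data.Product using (Σ; ∃; ∃-syntax; _×_; _,_; proj₁; proj₂)
open import Data.Sum using (_⊎_)
open import Data.Empty using (⊥)
open import Relation.Nullary using (¬_)
open import Relation.Binary.PropositionalEquality using (_≡_; _≢_)

-- Ground set E = {e₁,…,eₘ} is Fin m; eᵢ is the element with toℕ = i-1,
-- so the total order ≺ is the natural order of Fin m.

Signed : ℕ → Set
Signed m = Subset m × Subset m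

module _ {m : ℕ} where

  pos neg supp : Signed m → Subset m
  pos X = proj₁ X
  neg X = proj₂ X
  supp X = pos X ∪ neg X

  -_ : Signed m → Signed m
  - X = (neg X , pos X)

  Family : Set₁
  Family = Signed m → Set

record OrientedMatroid (m : ℕ) : Set where
  field
    circuit : Signed m → Bool
  IsCircuit : Signed m → Set
  IsCircuit X = circuit X ≡ true
  field
    disjoint : ∀ X → IsCircuit X → pos X ∩ neg X ≡ ∅
    C0 : circuit (∅ , ∅) ≡ false
    C1 : ∀ X → IsCircuit X → IsCircuit (- X)
    C2 : ∀ X Y → IsCircuit X → IsCircuit Y → supp X ⊆ supp Y → (X ≡ Y) ⊎ (X ≡ - Y)
    C3 : ∀ X Y e → IsCircuit X → IsCircuit Y → X ≢ - Y → e ∈ pos X → e ∈ neg Y →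
         ∃[ Z ] (IsCircuit Z × pos Z ⊆ (pos X ∪ pos Y) ─ ⁅ e ⁆
                             × neg Z ⊆ (neg X ∪ neg Y) ─ ⁅ e ⁆)

open OrientedMatroid public

module _ {m : ℕ} where

  Loopless : OrientedMatroid m → Set
  Loopless M = ∀ X → IsCircuit M X → ∀ e → supp X ≢ ⁅ e ⁆

  Acyclic : Family {m} → Set
  Acyclic C = ∀ X → C X → neg X ≡ ∅ → ⊥

  reorient : Subset m → Signed m → Signed m
  reorient A X = ((pos X ─ A) ∪ (neg X ∩ A) , (neg X ─ A) ∪ (pos X ∩ A))

  Reor : Subset m → Family {m} → Family {m}
  Reor A C X = ∃[ Y ] (C Y × X ≡ reorient A Y)

  Del : Subset m → Family {m} → Family {m}
  Del S C Y = C Y × supp Y ⊆ ∁ S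

  restrict : Subset m → Signed m → Signed m
  restrict S Y = (pos Y ─ S , neg Y ─ S)

  Con : Subset m → Family {m} → Family {m}
  Con S C Z = (∃[ Y ] (C Y × Z ≡ restrict S Y))
            × Nonempty (supp Z)
            × (∀ Y → C Y → Nonempty (supp (restrict S Y)) → ¬ (supp (restrict S Y) ⊂ supp Z))

  E : ℕ → Subset m
  E n = tabulate (λ i → toℕ i <ᵇ n)

  IsMax : Fin m → Subset m → Set
  IsMax e S = e ∈ S × (∀ f → f ∈ S → toℕ f ≤ toℕ e)

  NBC : OrientedMatroid m → Subset m → Set
  NBC M N = ∀ X → IsCircuit M X → ∀ e → IsMax e (supp X) → ¬ (supp X ─ ⁅ e ⁆ ⊆ N)

  Mk : OrientedMatroid m → ℕ → Subset m → Subset m → Family {m}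
  Mk M n N A = Reor A (Con N (Del (E n ─ N) (IsCircuit M)))

  InN : OrientedMatroid m → ℕ → Subset m → Subset m → Set
  InN M n N A = N ⊆ E n × A ⊆ ∁ (E n) × NBC M N × Acyclic (Mk M n N A)

  -- graph of ψ_k, where k : Fin m is the (0-based) index of e_k, so that
  -- E_{k-1} = E (toℕ k) and E_k = E (suc (toℕ k)).
  Psi : OrientedMatroid m → Fin m → (Subset m × Subset m) → (Subset m × Subset m) → Set
  Psi M k (N' , A') (N , A) =
      (k ∉ A' × Acyclic (Reor ⁅ k ⁆ (Mk M (toℕ k) N' A')) × N ≡ N' ∪ ⁅ k ⁆ × A ≡ A')
    ⊎ (k ∉ A' × ¬ Acyclic (Reor ⁅ k ⁆ (Mk M (toℕ k) N' A')) × N ≡ N' × A ≡ A')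
    ⊎ (k ∈ A' × N ≡ N' × A ≡ A' ─ ⁅ k ⁆)

-- If N is independent, then for every circuit W of M \ S the signed set W − N conforms to some
-- circuit of (M \ S)/N: by strong induction on |W − N| take any contraction circuit below W − N and
-- remove its sign disagreements with W one at a time by circuit elimination.  Hence a reorientation
-- of (M \ S)/N on A is acyclic exactly when no circuit of M \ S becomes positive off N after
-- reorienting on A, and all acyclicity conditions turn into statements about circuits of M.
--
-- If e_k ∈ N, the preimage is (N − e_k, A).  If e_k ∉ N and some circuit of M \ (E_{k-1} − N) becomes
-- positive off N on reorienting A ∪ {e_k}, the preimage is (N, A): a positive circuit of M_{k-1} must
-- contain e_k, and eliminating e_k between the two circuits yields a circuit of M \ (E_k − N) that is
-- positive off N on reorienting A, unless the two circuits are opposite, in which case removing the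
-- maximal element e_k leaves a broken circuit inside N.  Otherwise the preimage is (N, A ∪ {e_k}).

module Submission where

open import Data.Bool using (true)
import Data.Bool.Properties as Bool
open import Data.Empty using (⊥; ⊥-elim)
open import Data.Fin using (Fin; toℕ; zero; suc; _≟_)
open import Data.Fin.Properties using (toℕ-injective)
open import Data.Fin.Subset using (Subset; _∈_; _∉_; _⊆_; _⊂_; _∪_; _∩_; _─_; ∁; ⁅_⁆; Nonempty; Empty; ∣_∣; inside; outside)
  renaming (⊥ to ∅)
open import Data.Fin.Subset.Properties
open import Data.Nat using (ℕ; suc; _≤_; _<_; z≤n; s≤s)
import Data.Nat.Properties as ℕ
open import Data.Nat.Induction using (<-wellFounded)
open import Data.Product using (∃; ∃-syntax; _×_; _,_; proj₁; proj₂)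
import Data.Product.Properties as Product
open import Data.Sum using (_⊎_; inj₁; inj₂; [_,_]′)
open import Data.Vec using (_∷_; here; there)
open import Data.Vec.Properties using ([]=⇒lookup; lookup⇒[]=; lookup∘tabulate)
import Data.Vec.Properties as Vec
open import Function using (Equivalence)
open import Induction.WellFounded using (module All)
import Relation.Binary.Construct.On as On
open import Relation.Nullary using (¬_; Dec; yes; no; contradiction)
open import Relation.Nullary.Decidable using (_×-dec_; map′)
open import Relation.Binary.PropositionalEquality using (_≡_; _≢_; refl; sym; trans; cong; cong₂; subst)

open import Defs

private
  variable
    m n : ℕ
    x e k : Fin m
    p q r s A B N S : Subset m
    X Y Z V W : Signed m

x∈p─q⇒x∉q : (p q : Subset m) → x ∈ p ─ q → x ∉ q
x∈p─q⇒x∉q (inside ∷ p) (outside ∷ q) here ()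
x∈p─q⇒x∉q (_ ∷ p) (_ ∷ q) (there x∈p─q) (there x∈q) = x∈p─q⇒x∉q p q x∈p─q x∈q

∪-mono : p ⊆ r → q ⊆ s → p ∪ q ⊆ r ∪ s
∪-mono p⊆r q⊆s x∈ with x∈p∪q⁻ _ _ x∈
... | inj₁ x∈p = x∈p∪q⁺ (inj₁ (p⊆r x∈p))
... | inj₂ x∈q = x∈p∪q⁺ (inj₂ (q⊆s x∈q))

∪-least : p ⊆ r → q ⊆ r → p ∪ q ⊆ r
∪-least p⊆r q⊆r x∈ = [ p⊆r , q⊆r ]′ (x∈p∪q⁻ _ _ x∈)

─-monoˡ : p ⊆ q → p ─ r ⊆ q ─ r
─-monoˡ p⊆q x∈ = x∈p∧x∉q⇒x∈p─q (p⊆q (p─q⊆p _ _ x∈)) (x∈p─q⇒x∉q _ _ x∈)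

─-antitoneʳ : q ⊆ r → p ─ r ⊆ p ─ q
─-antitoneʳ q⊆r x∈ = x∈p∧x∉q⇒x∈p─q (p─q⊆p _ _ x∈) (λ x∈q → x∈p─q⇒x∉q _ _ x∈ (q⊆r x∈q))

∩-monoˡ : p ⊆ q → p ∩ r ⊆ q ∩ r
∩-monoˡ p⊆q x∈ = x∈p∩q⁺ (p⊆q (p∩q⊆p _ _ x∈) , p∩q⊆q _ _ x∈)

≡∅⇒∉ : p ≡ ∅ → x ∉ p
≡∅⇒∉ p≡∅ x∈ = ∉⊥ (subst (_ ∈_) p≡∅ x∈)

∉⇒≡∅ : (∀ {x} → x ∉ p) → p ≡ ∅
∉⇒≡∅ ∉p = Empty-unique λ (_ , x∈) → ∉p x∈

p─⁅x⁆∪⁅x⁆ : x ∈ p → p ≡ (p ─ ⁅ x ⁆) ∪ ⁅ x ⁆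
p─⁅x⁆∪⁅x⁆ {x = x} {p = p} x∈p = ⊆-antisym ⊆∪ (∪-least (p─q⊆p _ _) λ y∈ → subst (_∈ p) (sym (x∈⁅y⁆⇒x≡y x y∈)) x∈p)
  where
  ⊆∪ : p ⊆ (p ─ ⁅ x ⁆) ∪ ⁅ x ⁆
  ⊆∪ {y} y∈p with y ≟ x
  ... | yes refl = x∈p∪q⁺ (inj₂ (x∈⁅x⁆ x))
  ... | no y≢x = x∈p∪q⁺ (inj₁ (x∈p∧x∉q⇒x∈p─q y∈p (x≢y⇒x∉⁅y⁆ y≢x)))

p∪⁅x⁆─⁅x⁆ : x ∉ p → p ≡ (p ∪ ⁅ x ⁆) ─ ⁅ x ⁆
p∪⁅x⁆─⁅x⁆ {x = x} x∉p = ⊆-antisym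
  (λ y∈ → x∈p∧x∉q⇒x∈p─q (p⊆p∪q _ y∈) λ y∈⁅x⁆ → x∉p (subst (_∈ _) (x∈⁅y⁆⇒x≡y x y∈⁅x⁆) y∈))
  (λ y∈ → [ (λ y∈p → y∈p) , (λ y∈⁅x⁆ → ⊥-elim (x∈p─q⇒x∉q _ _ y∈ y∈⁅x⁆)) ]′ (x∈p∪q⁻ _ _ (p─q⊆p _ _ y∈)))

max-exists : (p : Subset m) → Nonempty p → ∃[ e ] IsMax e p
max-exists (s ∷ p) ne with nonempty? p
... | yes ne′ with max-exists p ne′
...   | e , e∈ , ≤e = suc e , there e∈ , λ { zero _ → z≤n ; (suc f) (there f∈) → s≤s (≤e f f∈) }
max-exists (s ∷ p) (zero , here) | no empty =
  zero , here , λ { zero _ → z≤n ; (suc f) (there f∈) → ⊥-elim (empty (f , f∈)) }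
max-exists (s ∷ p) (suc f , there f∈) | no empty = ⊥-elim (empty (f , f∈))

∈E⇒< : x ∈ E n → toℕ x < n
∈E⇒< {x = x} {n} x∈ = ℕ.<ᵇ⇒< (toℕ x) n
  (Equivalence.from Bool.T-≡ (trans (sym (lookup∘tabulate _ x)) ([]=⇒lookup x∈)))

<⇒∈E : toℕ x < n → x ∈ E n
<⇒∈E {x = x} x<n =
  lookup⇒[]= x _ (trans (lookup∘tabulate _ x) (Equivalence.to Bool.T-≡ (ℕ.<⇒<ᵇ x<n)))

E-mono : E n ⊆ E {m} (suc n)
E-mono x∈ = <⇒∈E (ℕ.m<n⇒m<1+n (∈E⇒< x∈))

E-suc⁻ : x ∈ E (suc (toℕ k)) → x ≢ k → x ∈ E (toℕ k)
E-suc⁻ x∈ x≢k = <⇒∈E (ℕ.≤∧≢⇒< (ℕ.≤-pred (∈E⇒< x∈)) (λ eq → x≢k (toℕ-injective eq)))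

k∈E-suc : k ∈ E (suc (toℕ k))
k∈E-suc = <⇒∈E (ℕ.n<1+n _)

k∉E : k ∉ E (toℕ k)
k∉E k∈ = ℕ.<-irrefl refl (∈E⇒< k∈)

anySigned? : {P : Signed m → Set} → (∀ X → Dec (P X)) → Dec (∃ P)
anySigned? P? = map′ (λ (p , q , h) → (p , q) , h) (λ ((p , q) , h) → p , q , h)
  (anySubset? λ p → anySubset? λ q → P? (p , q))

_≟ₛ_ : (X Y : Signed m) → Dec (X ≡ Y)
_≟ₛ_ = Product.≡-dec (Vec.≡-dec Bool._≟_) (Vec.≡-dec Bool._≟_)

infix 4 _≼_
_≼_ : Signed m → Signed m → Set
X ≼ Y = pos X ⊆ pos Y × neg X ⊆ neg Y

≼-refl : X ≼ X
≼-refl = (λ x∈ → x∈) , (λ x∈ → x∈)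

≼-trans : X ≼ Y → Y ≼ Z → X ≼ Z
≼-trans (p₁ , n₁) (p₂ , n₂) = (λ x∈ → p₂ (p₁ x∈)) , (λ x∈ → n₂ (n₁ x∈))

supp-mono : X ≼ Y → supp X ⊆ supp Y
supp-mono (p⊆ , n⊆) = ∪-mono p⊆ n⊆

infixr 6 _∪ₛ_
_∪ₛ_ : Signed m → Signed m → Signed m
X ∪ₛ Y = (pos X ∪ pos Y , neg X ∪ neg Y)

IsSignedSet : Signed m → Set
IsSignedSet X = ∀ {x} → x ∈ pos X → x ∉ neg X

sep : Signed m → Signed m → Subset m
sep X Y = (pos X ∩ neg Y) ∪ (neg X ∩ pos Y)

sep⊆suppˡ : sep X Y ⊆ supp X
sep⊆suppˡ = ∪-mono (p∩q⊆p _ _) (p∩q⊆p _ _)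

sep⊆suppʳ : sep X Y ⊆ supp Y
sep⊆suppʳ x∈ with x∈p∪q⁻ _ _ x∈
... | inj₁ x∈pn = x∈p∪q⁺ (inj₂ (p∩q⊆q _ _ x∈pn))
... | inj₂ x∈np = x∈p∪q⁺ (inj₁ (p∩q⊆q _ _ x∈np))

sep-mono : X ≼ Y → Z ≼ V → sep X Z ⊆ sep Y V
sep-mono (pX , nX) (pZ , nZ) = ∪-mono (∩-mono pX nZ) (∩-mono nX pZ)
  where
  ∩-mono : p ⊆ r → q ⊆ s → p ∩ q ⊆ r ∩ s
  ∩-mono p⊆r q⊆s x∈ = x∈p∩q⁺ (p⊆r (p∩q⊆p _ _ x∈) , q⊆s (p∩q⊆q _ _ x∈))

sep-∪ₛ : IsSignedSet V → X ≼ Y ∪ₛ V → sep X V ⊆ sep Y V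
sep-∪ₛ {V = V} {Y = Y} signed (pX , nX) x∈ with x∈p∪q⁻ _ _ x∈
... | inj₁ x∈pn with x∈p∩q⁻ _ _ x∈pn
...   | x∈pX , x∈nV with x∈p∪q⁻ (pos Y) (pos V) (pX x∈pX)
...     | inj₁ x∈pY = x∈p∪q⁺ (inj₁ (x∈p∩q⁺ (x∈pY , x∈nV)))
...     | inj₂ x∈pV = ⊥-elim (signed x∈pV x∈nV)
sep-∪ₛ {V = V} {Y = Y} signed (pX , nX) x∈ | inj₂ x∈np with x∈p∩q⁻ _ _ x∈np
...   | x∈nX , x∈pV with x∈p∪q⁻ (neg Y) (neg V) (nX x∈nX)
...     | inj₁ x∈nY = x∈p∪q⁺ (inj₂ (x∈p∩q⁺ (x∈nY , x∈pV)))
...     | inj₂ x∈nV = ⊥-elim (signed x∈pV x∈nV)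

≼-if-sep-empty : supp X ⊆ supp V → Empty (sep X V) → X ≼ V
≼-if-sep-empty {X = X} {V = V} X⊆V no-sep = pos⊆ , neg⊆
  where
  pos⊆ : pos X ⊆ pos V
  pos⊆ x∈ with x∈p∪q⁻ _ _ (X⊆V (x∈p∪q⁺ (inj₁ x∈)))
  ... | inj₁ x∈pV = x∈pV
  ... | inj₂ x∈nV = ⊥-elim (no-sep (_ , x∈p∪q⁺ (inj₁ (x∈p∩q⁺ (x∈ , x∈nV)))))
  neg⊆ : neg X ⊆ neg V
  neg⊆ x∈ with x∈p∪q⁻ _ _ (X⊆V (x∈p∪q⁺ (inj₂ x∈)))
  ... | inj₁ x∈pV = ⊥-elim (no-sep (_ , x∈p∪q⁺ (inj₂ (x∈p∩q⁺ (x∈ , x∈pV)))))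
  ... | inj₂ x∈nV = x∈nV

supp-∪ₛ : supp (X ∪ₛ Y) ⊆ supp X ∪ supp Y
supp-∪ₛ = ∪-least (∪-mono (p⊆p∪q _) (p⊆p∪q _)) (∪-mono (q⊆p∪q _ _) (q⊆p∪q _ _))

IsSignedSet-≼ : X ≼ Y → IsSignedSet Y → IsSignedSet X
IsSignedSet-≼ (p⊆ , n⊆) signed x∈p x∈n = signed (p⊆ x∈p) (n⊆ x∈n)

∉supp-─⁅⁆ : pos Z ⊆ p ─ ⁅ e ⁆ → neg Z ⊆ q ─ ⁅ e ⁆ → e ∉ supp Z
∉supp-─⁅⁆ {e = e} pZ nZ e∈ with x∈p∪q⁻ _ _ e∈
... | inj₁ e∈p = x∈p─q⇒x∉q _ _ (pZ e∈p) (x∈⁅x⁆ e)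
... | inj₂ e∈n = x∈p─q⇒x∉q _ _ (nZ e∈n) (x∈⁅x⁆ e)

restrict-≼ : restrict S X ≼ X
restrict-≼ = p─q⊆p _ _ , p─q⊆p _ _

restrict-mono : X ≼ Y → restrict S X ≼ restrict S Y
restrict-mono (p⊆ , n⊆) = ─-monoˡ p⊆ , ─-monoˡ n⊆

restrict-antitone : q ⊆ p → restrict p X ≼ restrict q X
restrict-antitone q⊆p = ─-antitoneʳ q⊆p , ─-antitoneʳ q⊆p

restrict-∪ₛ : restrict S (X ∪ₛ Y) ≼ restrict S X ∪ₛ restrict S Y
restrict-∪ₛ = ─-∪ , ─-∪
  where
  ─-∪ : (p ∪ q) ─ r ⊆ (p ─ r) ∪ (q ─ r)
  ─-∪ x∈ with x∈p∪q⁻ _ _ (p─q⊆p _ _ x∈)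
  ... | inj₁ x∈p = x∈p∪q⁺ (inj₁ (x∈p∧x∉q⇒x∈p─q x∈p (x∈p─q⇒x∉q _ _ x∈)))
  ... | inj₂ x∈q = x∈p∪q⁺ (inj₂ (x∈p∧x∉q⇒x∈p─q x∈q (x∈p─q⇒x∉q _ _ x∈)))

∈-restrict : x ∈ supp X → x ∉ S → x ∈ supp (restrict S X)
∈-restrict x∈ x∉S with x∈p∪q⁻ _ _ x∈
... | inj₁ x∈p = x∈p∪q⁺ (inj₁ (x∈p∧x∉q⇒x∈p─q x∈p x∉S))
... | inj₂ x∈n = x∈p∪q⁺ (inj₂ (x∈p∧x∉q⇒x∈p─q x∈n x∉S))

∉-restrict : x ∈ supp (restrict S X) → x ∉ S
∉-restrict x∈ with x∈p∪q⁻ _ _ x∈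
... | inj₁ x∈p = x∈p─q⇒x∉q _ _ x∈p
... | inj₂ x∈n = x∈p─q⇒x∉q _ _ x∈n

Positive : Signed m → Set
Positive X = ∀ {x} → x ∉ neg X

Positive? : ∀ X → Dec (Positive {m} X)
Positive? X = map′ (λ neg≡∅ → ≡∅⇒∉ neg≡∅) ∉⇒≡∅ (Vec.≡-dec Bool._≟_ (neg X) ∅)

reorient-mono : X ≼ Y → reorient B X ≼ reorient B Y
reorient-mono (p⊆ , n⊆) = ∪-mono (─-monoˡ p⊆) (∩-monoˡ n⊆) , ∪-mono (─-monoˡ n⊆) (∩-monoˡ p⊆)

neg-reorient⊆supp : neg (reorient B X) ⊆ supp X
neg-reorient⊆supp x∈ with x∈p∪q⁻ _ _ x∈
... | inj₁ x∈n = x∈p∪q⁺ (inj₂ (p─q⊆p _ _ x∈n))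
... | inj₂ x∈p = x∈p∪q⁺ (inj₁ (p∩q⊆p _ _ x∈p))

neg-reorient⁺ : x ∈ neg X → x ∉ B → x ∈ neg (reorient B X)
neg-reorient⁺ x∈n x∉B = x∈p∪q⁺ (inj₁ (x∈p∧x∉q⇒x∈p─q x∈n x∉B))

neg-reorient⁺′ : x ∈ pos X → x ∈ B → x ∈ neg (reorient B X)
neg-reorient⁺′ x∈p x∈B = x∈p∪q⁺ (inj₂ (x∈p∩q⁺ (x∈p , x∈B)))

supp-reorient : x ∈ supp X → x ∈ supp (reorient B X)
supp-reorient {x = x} {B = B} x∈ with x ∈? B | x∈p∪q⁻ _ _ x∈
... | yes x∈B | inj₁ x∈p = x∈p∪q⁺ (inj₂ (neg-reorient⁺′ x∈p x∈B))
... | no  x∉B | inj₁ x∈p = x∈p∪q⁺ (inj₁ (x∈p∪q⁺ (inj₁ (x∈p∧x∉q⇒x∈p─q x∈p x∉B))))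
... | yes x∈B | inj₂ x∈n = x∈p∪q⁺ (inj₁ (x∈p∪q⁺ (inj₂ (x∈p∩q⁺ (x∈n , x∈B)))))
... | no  x∉B | inj₂ x∈n = x∈p∪q⁺ (inj₂ (neg-reorient⁺ x∈n x∉B))

neg-reorient-∪ₛ : neg (reorient B (X ∪ₛ Y)) ⊆ neg (reorient B X) ∪ neg (reorient B Y)
neg-reorient-∪ₛ x∈ with x∈p∪q⁻ _ _ x∈
... | inj₁ x∈n with x∈p∪q⁻ _ _ (p─q⊆p _ _ x∈n)
...   | inj₁ x∈nX = x∈p∪q⁺ (inj₁ (neg-reorient⁺ x∈nX (x∈p─q⇒x∉q _ _ x∈n)))
...   | inj₂ x∈nY = x∈p∪q⁺ (inj₂ (neg-reorient⁺ x∈nY (x∈p─q⇒x∉q _ _ x∈n)))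
neg-reorient-∪ₛ x∈ | inj₂ x∈p with x∈p∪q⁻ _ _ (p∩q⊆p _ _ x∈p)
...   | inj₁ x∈pX = x∈p∪q⁺ (inj₁ (neg-reorient⁺′ x∈pX (p∩q⊆q _ _ x∈p)))
...   | inj₂ x∈pY = x∈p∪q⁺ (inj₂ (neg-reorient⁺′ x∈pY (p∩q⊆q _ _ x∈p)))

neg-reorient-extend : x ∈ neg (reorient A X) → x ∉ B → x ∈ neg (reorient (A ∪ B) X)
neg-reorient-extend x∈ x∉B with x∈p∪q⁻ _ _ x∈
... | inj₁ x∈n = neg-reorient⁺ (p─q⊆p _ _ x∈n)
                   λ x∈A∪B → [ x∈p─q⇒x∉q _ _ x∈n , x∉B ]′ (x∈p∪q⁻ _ _ x∈A∪B)
... | inj₂ x∈p = neg-reorient⁺′ (p∩q⊆p _ _ x∈p) (x∈p∪q⁺ (inj₁ (p∩q⊆q _ _ x∈p)))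

neg-reorient-⁅⁆∘reorient : k ∉ A → neg (reorient ⁅ k ⁆ (reorient A X)) ⊆ neg (reorient (A ∪ ⁅ k ⁆) X)
neg-reorient-⁅⁆∘reorient {k = k} k∉A x∈ with x∈p∪q⁻ _ _ x∈
... | inj₁ x∈n = neg-reorient-extend (p─q⊆p _ _ x∈n) (x∈p─q⇒x∉q _ _ x∈n)
... | inj₂ x∈p with x∈⁅y⁆⇒x≡y k (p∩q⊆q _ _ x∈p) | x∈p∪q⁻ _ _ (p∩q⊆p _ _ x∈p)
...   | refl | inj₁ k∈p = neg-reorient⁺′ (p─q⊆p _ _ k∈p) (x∈p∪q⁺ (inj₂ (x∈⁅x⁆ k)))
...   | refl | inj₂ k∈n = ⊥-elim (k∉A (p∩q⊆q _ _ k∈n))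

neg-reorient-restrict⊆supp : neg (reorient B (restrict S X)) ⊆ supp X
neg-reorient-restrict⊆supp x∈ = supp-mono restrict-≼ (neg-reorient⊆supp x∈)

-- Away from k, reorienting on A or on A ∪ {k} is the same.
positive-off-k : Positive (reorient A (restrict N X)) → Positive (reorient (A ∪ ⁅ k ⁆) (restrict N Y)) →
                 Z ≼ X ∪ₛ Y → k ∉ supp Z → Positive (reorient A (restrict N Z))
positive-off-k {k = k} posX posY Z≼ k∉Z x∈
  with x∈p∪q⁻ _ _ (neg-reorient-∪ₛ (proj₂ (reorient-mono (≼-trans (restrict-mono Z≼) restrict-∪ₛ)) x∈))
... | inj₁ x∈X = posX x∈X
... | inj₂ x∈Y = posY (neg-reorient-extend x∈Y (x≢y⇒x∉⁅y⁆ λ { refl → k∉Z (neg-reorient-restrict⊆supp x∈) }))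

Del-∪ₛ : {F : Family {m}} → Del S F X → Del S F Y → F Z → Z ≼ X ∪ₛ Y → Del S F Z
Del-∪ₛ (_ , X⊆) (_ , Y⊆) FZ Z≼ = FZ , ⊆-trans (supp-mono Z≼) (⊆-trans supp-∪ₛ (∪-least X⊆ Y⊆))

Del-antitone : {F : Family {m}} → S ⊆ r → Del r F Y → Del S F Y
Del-antitone S⊆r (FY , Y⊆∁r) = FY , λ x∈ → p⊆q⇒∁p⊇∁q S⊆r (Y⊆∁r x∈)

module _ (M : OrientedMatroid m) where

  circuit-signed : IsCircuit M X → IsSignedSet X
  circuit-signed {X = X} cX x∈p x∈n = ∉⊥ (subst (_ ∈_) (disjoint M X cX) (x∈p∩q⁺ (x∈p , x∈n)))

  circuit-nonempty : IsCircuit M X → Nonempty (supp X)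
  circuit-nonempty {X = X} cX with nonempty? (supp X)
  ... | yes ne = ne
  ... | no empty = contradiction (trans (sym (C0 M)) (subst (λ Y → circuit M Y ≡ true) X≡∅ cX)) λ ()
    where
    X≡∅ : X ≡ (∅ , ∅)
    X≡∅ = cong₂ _,_ (Empty-unique λ (x , x∈) → empty (x , x∈p∪q⁺ (inj₁ x∈)))
                    (Empty-unique λ (x , x∈) → empty (x , x∈p∪q⁺ (inj₂ x∈)))

  NBC⇒independent : NBC M N → IsCircuit M X → ¬ supp X ⊆ N
  NBC⇒independent nbc cX X⊆N with max-exists _ (circuit-nonempty cX)
  ... | e , e-max = nbc _ cX e e-max (λ x∈ → X⊆N (p─q⊆p _ _ x∈))

  NBC-⊆ : q ⊆ p → NBC M p → NBC M q
  NBC-⊆ q⊆p nbc X cX e e-max broken = nbc X cX e e-max (λ x∈ → q⊆p (broken x∈))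

  eliminate : IsCircuit M X → IsCircuit M Y → X ≢ - Y → e ∈ sep X Y →
              ∃[ Z ] (IsCircuit M Z × Z ≼ X ∪ₛ Y × e ∉ supp Z)
  eliminate {X = X} {Y = Y} {e = e} cX cY X≢-Y e∈ with x∈p∪q⁻ _ _ e∈
  ... | inj₁ e∈pn with C3 M X Y e cX cY X≢-Y (p∩q⊆p _ _ e∈pn) (p∩q⊆q _ _ e∈pn)
  ...   | Z , cZ , pZ , nZ =
    Z , cZ , ((λ x∈ → p─q⊆p _ _ (pZ x∈)) , (λ x∈ → p─q⊆p _ _ (nZ x∈))) , ∉supp-─⁅⁆ pZ nZ
  eliminate {X = X} {Y = Y} {e = e} cX cY X≢-Y e∈ | inj₂ e∈np
    with C3 M Y X e cY cX (λ Y≡-X → X≢-Y (cong -_ (sym Y≡-X))) (p∩q⊆q _ _ e∈np) (p∩q⊆p _ _ e∈np)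
  ... | Z , cZ , pZ , nZ =
    Z , cZ , ((λ x∈ → swap (p─q⊆p _ _ (pZ x∈))) , (λ x∈ → swap (p─q⊆p _ _ (nZ x∈)))) , ∉supp-─⁅⁆ pZ nZ
    where
    swap : p ∪ q ⊆ q ∪ p
    swap = ⊆-reflexive (∪-comm _ _)

module Contraction (M : OrientedMatroid m) (S N : Subset m)
                   (independent : ∀ {X} → IsCircuit M X → ¬ supp X ⊆ N) where

  D : Family
  D = Del S (IsCircuit M)

  D? : ∀ Y → Dec (D Y)
  D? Y = (circuit M Y Bool.≟ true) ×-dec (supp Y ⊆? ∁ S)

  restrict-nonempty : D W → Nonempty (supp (restrict N W))
  restrict-nonempty {W = W} (cW , _) with nonempty? (supp (restrict N W))
  ... | yes ne = ne
  ... | no empty = ⊥-elim (independent cW W⊆N)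
    where
    W⊆N : supp W ⊆ N
    W⊆N {x} x∈ with x ∈? N
    ... | yes x∈N = x∈N
    ... | no x∉N = ⊥-elim (empty (x , ∈-restrict x∈ x∉N))

  Con-neg : Con N D Y → Con N D (- Y)
  Con-neg ((W , (cW , W⊆∁S) , refl) , (x , x∈) , minimal) =
    (- W , (C1 M W cW , λ x∈ → W⊆∁S (swap x∈)) , refl) , (x , swap x∈) ,
    λ Z dZ ne (Z⊆ , y , y∈ , y∉) → minimal Z dZ ne ((λ x∈ → swap (Z⊆ x∈)) , y , swap y∈ , y∉)
    where
    swap : p ∪ q ⊆ q ∪ p
    swap = ⊆-reflexive (∪-comm _ _)

  Conformal : Signed m → Set
  Conformal W = D W → ∃[ Y ] (Con N D Y × Y ≼ restrict N W)

  module Step {W} (dW : D W)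
    (ih : ∀ {Z} → ∣ supp (restrict N Z) ∣ < ∣ supp (restrict N W) ∣ → Conformal Z) where

    rW : Signed m
    rW = restrict N W

    Con-below : ∃[ Y ] (Con N D Y × supp Y ⊆ supp rW)
    Con-below with anySigned? (λ Y → D? Y ×-dec nonempty? _ ×-dec (supp (restrict N Y) ⊂? supp rW))
    ... | no none =
      rW , ((W , dW , refl) , restrict-nonempty dW , λ Y dY ne Y⊂W → none (Y , dY , ne , Y⊂W)) , (λ x∈ → x∈)
    ... | yes (Y₀ , dY₀ , _ , Y₀⊂W) with ih (p⊂q⇒∣p∣<∣q∣ Y₀⊂W) dY₀
    ...   | Y , cY , Y≼ = Y , cY , ⊆-trans (supp-mono Y≼) (proj₁ Y₀⊂W)

    shrink : D Y → supp (restrict N Y) ⊆ supp rW → IsCircuit M Z → Z ≼ Y ∪ₛ W →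
             e ∈ supp rW → e ∉ supp Z →
             ∃[ Y′ ] (Con N D Y′ × supp Y′ ⊆ supp rW × sep Y′ rW ⊆ sep (restrict N Y) rW × e ∉ supp Y′)
    shrink {Y = Y} {Z = Z} {e = e} dY Y⊆W cZ Z≼ e∈W e∉Z =
      let Y′ , cY′ , Y′≼ = ih (p⊂q⇒∣p∣<∣q∣ (rZ⊆rW , e , e∈W , e∉rZ)) (Del-∪ₛ dY dW cZ Z≼)
      in Y′ , cY′ , ⊆-trans (supp-mono Y′≼) rZ⊆rW ,
         sep-∪ₛ (IsSignedSet-≼ restrict-≼ (circuit-signed M (proj₁ dW))) (≼-trans Y′≼ rZ≼) ,
         λ e∈ → e∉rZ (supp-mono Y′≼ e∈)
      where
      rZ≼ : restrict N Z ≼ restrict N Y ∪ₛ rW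
      rZ≼ = ≼-trans (restrict-mono Z≼) restrict-∪ₛ
      rZ⊆rW : supp (restrict N Z) ⊆ supp rW
      rZ⊆rW = ⊆-trans (supp-mono rZ≼) (⊆-trans supp-∪ₛ (∪-least Y⊆W (λ x∈ → x∈)))
      e∉rZ : e ∉ supp (restrict N Z)
      e∉rZ e∈ = e∉Z (supp-mono restrict-≼ e∈)

    separation-step : Con N D Y → supp Y ⊆ supp rW → e ∈ sep Y rW →
                      Con N D rW ⊎ ∃[ Y′ ] (Con N D Y′ × supp Y′ ⊆ supp rW × sep Y′ rW ⊂ sep Y rW)
    separation-step {e = e} cY@((Y₀ , dY₀ , refl) , _) Y⊆W e∈ with Y₀ ≟ₛ (- W)
    ... | yes refl = inj₁ (Con-neg cY)
    ... | no Y₀≢-W with eliminate M (proj₁ dY₀) (proj₁ dW) Y₀≢-W (sep-mono restrict-≼ restrict-≼ e∈)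
    ...   | Z , cZ , Z≼ , e∉Z with shrink dY₀ Y⊆W cZ Z≼ (sep⊆suppʳ e∈) e∉Z
    ...     | Y′ , cY′ , Y′⊆W , sep⊆ , e∉Y′ =
      inj₂ (Y′ , cY′ , Y′⊆W , sep⊆ , e , e∈ , λ e∈′ → e∉Y′ (sep⊆suppˡ e∈′))

    align : Con N D Y → supp Y ⊆ supp rW → ∃[ Y′ ] (Con N D Y′ × Y′ ≼ rW)
    align {Y = Y} = All.wfRec (On.wellFounded (λ Y → ∣ sep Y rW ∣) <-wellFounded) _ Aligned go Y
      where
      Aligned : Signed m → Set
      Aligned Y = Con N D Y → supp Y ⊆ supp rW → ∃[ Y′ ] (Con N D Y′ × Y′ ≼ rW)
      go : ∀ Y → (∀ {Y′} → ∣ sep Y′ rW ∣ < ∣ sep Y rW ∣ → Aligned Y′) → Aligned Y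
      go Y rec cY Y⊆W with nonempty? (sep Y rW)
      ... | no empty = Y , cY , ≼-if-sep-empty Y⊆W empty
      ... | yes (e , e∈) with separation-step cY Y⊆W e∈
      ...   | inj₁ cW = rW , cW , ≼-refl
      ...   | inj₂ (Y′ , cY′ , Y′⊆W , sep⊂) = rec (p⊂q⇒∣p∣<∣q∣ sep⊂) cY′ Y′⊆W

  conformal : D W → ∃[ Y ] (Con N D Y × Y ≼ restrict N W)
  conformal {W = W} = All.wfRec (On.wellFounded (λ W → ∣ supp (restrict N W) ∣) <-wellFounded) _ Conformal
    (λ W ih dW → let Y , cY , Y⊆W = Step.Con-below dW ih in Step.align dW ih cY Y⊆W) W

  positive-restriction⇒cyclic : D W → Positive (reorient A (restrict N W)) → ¬ Acyclic (Reor A (Con N D))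
  positive-restriction⇒cyclic {A = A} dW positive acyclic =
    let Y , cY , Y≼ = conformal dW
    in acyclic (reorient A Y) (Y , cY , refl)
         (∉⇒≡∅ λ x∈ → positive (proj₂ (reorient-mono Y≼) x∈))

module Surjectivity (M : OrientedMatroid m) (k : Fin m) (N A : Subset m)
  (N⊆E : N ⊆ E (suc (toℕ k))) (A⊆∁E : A ⊆ ∁ (E (suc (toℕ k))))
  (nbc : NBC M N) (acyclic : Acyclic (Mk M (suc (toℕ k)) N A)) where

  t : ℕ
  t = toℕ k

  k∉A : k ∉ A
  k∉A k∈A = x∈∁p⇒x∉p (A⊆∁E k∈A) k∈E-suc

  A⊆∁Eₜ : A ⊆ ∁ (E t)
  A⊆∁Eₜ = ⊆-trans A⊆∁E (p⊆q⇒∁p⊇∁q E-mono)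

  no-positive-restriction : Del (E (suc t) ─ N) (IsCircuit M) Y → ¬ Positive (reorient A (restrict N Y))
  no-positive-restriction dY positive =
    Contraction.positive-restriction⇒cyclic M _ N (NBC⇒independent M nbc) dY positive acyclic

  Preimage : Set
  Preimage = ∃[ N′ ] ∃[ A′ ] (InN M t N′ A′ × Psi M k (N′ , A′) (N , A))

  preimage-k∈N : k ∈ N → Preimage
  preimage-k∈N k∈N =
    N′ , A , (N′⊆Eₜ , A⊆∁Eₜ , NBC-⊆ M (p─q⊆p _ _) nbc , acyclic′) ,
    inj₁ (k∉A , acyclic′-k , p─⁅x⁆∪⁅x⁆ k∈N , refl)
    where
    N′ : Subset m
    N′ = N ─ ⁅ k ⁆

    ∉N⇒≢k : x ∉ N → x ≢ k
    ∉N⇒≢k x∉N refl = x∉N k∈N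

    N′⊆Eₜ : N′ ⊆ E t
    N′⊆Eₜ x∈ = E-suc⁻ (N⊆E (p─q⊆p _ _ x∈)) (x∉⁅y⁆⇒x≢y (x∈p─q⇒x∉q _ _ x∈))

    Del-Eₜ⇒Del-Esuc : Del (E t ─ N′) (IsCircuit M) Y → Del (E (suc t) ─ N) (IsCircuit M) Y
    Del-Eₜ⇒Del-Esuc = Del-antitone {F = IsCircuit M} λ x∈ → let x∉N = x∈p─q⇒x∉q _ _ x∈ in
      x∈p∧x∉q⇒x∈p─q (E-suc⁻ (p─q⊆p _ _ x∈) (∉N⇒≢k x∉N)) (λ x∈N′ → x∉N (p─q⊆p _ _ x∈N′))

    reorient-restrict-N≼N′ : reorient B (restrict N Y) ≼ reorient B (restrict N′ Y)
    reorient-restrict-N≼N′ = reorient-mono (restrict-antitone (p─q⊆p _ _))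

    acyclic′ : Acyclic (Mk M t N′ A)
    acyclic′ _ (_ , ((Y , dY , refl) , _) , refl) neg≡∅ =
      no-positive-restriction (Del-Eₜ⇒Del-Esuc dY) λ x∈ → ≡∅⇒∉ neg≡∅ (proj₂ reorient-restrict-N≼N′ x∈)

    acyclic′-k : Acyclic (Reor ⁅ k ⁆ (Mk M t N′ A))
    acyclic′-k _ (_ , (_ , ((Y , dY , refl) , _) , refl) , refl) neg≡∅ =
      no-positive-restriction (Del-Eₜ⇒Del-Esuc dY) λ x∈ →
        ≡∅⇒∉ neg≡∅ (neg-reorient⁺ (proj₂ reorient-restrict-N≼N′ x∈)
          (x≢y⇒x∉⁅y⁆ (∉N⇒≢k (∉-restrict (neg-reorient⊆supp x∈)))))

  module _ (k∉N : k ∉ N) where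
    open Contraction M (E t ─ N) N (NBC⇒independent M nbc)

    N⊆Eₜ : N ⊆ E t
    N⊆Eₜ x∈ = E-suc⁻ (N⊆E x∈) λ { refl → k∉N x∈ }

    Del-avoiding-k : D Y → k ∉ supp Y → Del (E (suc t) ─ N) (IsCircuit M) Y
    Del-avoiding-k (cY , Y⊆) k∉Y = cY , λ x∈ → x∉p⇒x∈∁p λ x∈S → x∈∁p⇒x∉p (Y⊆ x∈)
      (x∈p∧x∉q⇒x∈p─q (E-suc⁻ (p─q⊆p _ _ x∈S) λ { refl → k∉Y x∈ }) (x∈p─q⇒x∉q _ _ x∈S))

    k-positive : Positive (reorient A (restrict N Y)) → k ∈ supp Y → k ∈ pos Y
    k-positive positive k∈ with x∈p∪q⁻ _ _ k∈
    ... | inj₁ k∈p = k∈p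
    ... | inj₂ k∈n = ⊥-elim (positive (neg-reorient⁺ (x∈p∧x∉q⇒x∈p─q k∈n k∉N) k∉A))

    k-negative : Positive (reorient (A ∪ ⁅ k ⁆) (restrict N Y)) → k ∈ supp Y → k ∈ neg Y
    k-negative positive k∈ with x∈p∪q⁻ _ _ k∈
    ... | inj₁ k∈p = ⊥-elim (positive (neg-reorient⁺′ (x∈p∧x∉q⇒x∈p─q k∈p k∉N) (x∈p∪q⁺ (inj₂ (x∈⁅x⁆ k)))))
    ... | inj₂ k∈n = k∈n

    -- Outside N, Y can only live on k; as k is ≺-maximal, supp Y − k is a broken circuit inside N.
    opposite-broken : IsCircuit M Y → Positive (reorient A (restrict N Y)) →
                      Positive (reorient (A ∪ ⁅ k ⁆) (restrict N (- Y))) → k ∈ supp Y → ⊥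
    opposite-broken {Y = Y} cY posY pos-Y k∈ =
      nbc _ cY k (k∈ , ≤k) (λ x∈ → off-k (p─q⊆p _ _ x∈) (x∉⁅y⁆⇒x≢y (x∈p─q⇒x∉q _ _ x∈)))
      where
      off-k : x ∈ supp Y → x ≢ k → x ∈ N
      off-k {x = x} x∈ x≢k with x ∈? N
      ... | yes x∈N = x∈N
      ... | no x∉N with x∈p∪q⁻ _ _ (supp-reorient {B = A} (∈-restrict x∈ x∉N))
      ...   | inj₁ x∈pos = ⊥-elim (pos-Y (neg-reorient-extend x∈pos (x≢y⇒x∉⁅y⁆ x≢k)))
      ...   | inj₂ x∈neg = ⊥-elim (posY x∈neg)
      ≤k : ∀ f → f ∈ supp Y → toℕ f ≤ toℕ k
      ≤k f f∈ with f ≟ k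
      ... | yes refl = ℕ.≤-refl
      ... | no f≢k = ℕ.<⇒≤ (∈E⇒< (N⊆Eₜ (off-k f∈ f≢k)))

    no-positive-pair : D X → Positive (reorient A (restrict N X)) →
                   D Y → Positive (reorient (A ∪ ⁅ k ⁆) (restrict N Y)) → ⊥
    no-positive-pair {X = Yu} {Y = Yx} dYu posu dYx posx with k ∈? supp Yu | k ∈? supp Yx
    ... | no k∉Yu | _ = no-positive-restriction (Del-avoiding-k dYu k∉Yu) posu
    ... | yes _ | no k∉Yx =
      no-positive-restriction (Del-avoiding-k dYx k∉Yx)
        (positive-off-k {A = A} {N = N} {X = Yu} {k = k} {Y = Yx} posu posx (q⊆p∪q _ _ , q⊆p∪q _ _) k∉Yx)
    ... | yes k∈Yu | yes k∈Yx with Yu ≟ₛ (- Yx)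
    ...   | yes refl = opposite-broken (proj₁ dYu) posu posx k∈Yu
    ...   | no Yu≢-Yx =
      let Z , cZ , Z≼ , k∉Z = eliminate M (proj₁ dYu) (proj₁ dYx) Yu≢-Yx
                                (x∈p∪q⁺ (inj₁ (x∈p∩q⁺ (k-positive posu k∈Yu , k-negative posx k∈Yx))))
      in no-positive-restriction (Del-avoiding-k (Del-∪ₛ dYu dYx cZ Z≼) k∉Z)
           (positive-off-k {A = A} {N = N} {X = Yu} {k = k} {Y = Yx} posu posx Z≼ k∉Z)

    acyclic-Mₜ : D Y → Positive (reorient (A ∪ ⁅ k ⁆) (restrict N Y)) → Acyclic (Mk M t N A)
    acyclic-Mₜ dY posY _ (_ , ((X , dX , refl) , _) , refl) neg≡∅ = no-positive-pair dX (≡∅⇒∉ neg≡∅) dY posY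

    cyclic-Mₜ-k : D Y → Positive (reorient (A ∪ ⁅ k ⁆) (restrict N Y)) → ¬ Acyclic (Reor ⁅ k ⁆ (Mk M t N A))
    cyclic-Mₜ-k dY posY acyclic-k =
      let Y′ , cY′ , Y′≼ = conformal dY
      in acyclic-k (reorient ⁅ k ⁆ (reorient A Y′)) (reorient A Y′ , (Y′ , cY′ , refl) , refl)
           (∉⇒≡∅ λ x∈ → posY (proj₂ (reorient-mono Y′≼) (neg-reorient-⁅⁆∘reorient k∉A x∈)))

    PositiveOnA∪k : Set
    PositiveOnA∪k = ∃[ Y ] (D Y × Positive (reorient (A ∪ ⁅ k ⁆) (restrict N Y)))

    acyclic-Mₜ-A∪k : ¬ PositiveOnA∪k → Acyclic (Mk M t N (A ∪ ⁅ k ⁆))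
    acyclic-Mₜ-A∪k none _ (_ , ((Y , dY , refl) , _) , refl) neg≡∅ = none (Y , dY , ≡∅⇒∉ neg≡∅)

    A∪k⊆∁Eₜ : A ∪ ⁅ k ⁆ ⊆ ∁ (E t)
    A∪k⊆∁Eₜ = ∪-least A⊆∁Eₜ λ x∈ → x∉p⇒x∈∁p (subst (_∉ E t) (sym (x∈⁅y⁆⇒x≡y k x∈)) k∉E)

    preimage-from : Dec PositiveOnA∪k → Preimage
    preimage-from (yes (Y , dY , posY)) =
      N , A , (N⊆Eₜ , A⊆∁Eₜ , nbc , acyclic-Mₜ dY posY) , inj₂ (inj₁ (k∉A , cyclic-Mₜ-k dY posY , refl , refl))
    preimage-from (no none) =
      N , A ∪ ⁅ k ⁆ , (N⊆Eₜ , A∪k⊆∁Eₜ , nbc , acyclic-Mₜ-A∪k none) ,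
      inj₂ (inj₂ (x∈p∪q⁺ (inj₂ (x∈⁅x⁆ k)) , refl , p∪⁅x⁆─⁅x⁆ k∉A))

    preimage-k∉N : Preimage
    preimage-k∉N = preimage-from (anySigned? λ Y → D? Y ×-dec Positive? (reorient (A ∪ ⁅ k ⁆) (restrict N Y)))

  preimage : Preimage
  preimage with k ∈? N
  ... | yes k∈N = preimage-k∈N k∈N
  ... | no k∉N = preimage-k∉N k∉N

lemma2p5 : ∀ (m : ℕ) (M : OrientedMatroid m) → Loopless M → (k : Fin m) →
    ∀ (N A : Subset m) → InN M (suc (toℕ k)) N A →
    ∃[ N' ] ∃[ A' ] (InN M (toℕ k) N' A' × Psi M k (N' , A') (N , A))
lemma2p5 m M _ k N A (N⊆E , A⊆∁E , nbc , acyclic) = Surjectivity.preimage M k N A N⊆E A⊆∁E nbc acyclic
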